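{- (i) Let $\theta:[N]\to\mathbb{Z}$ be an order-preserving injection and $\theta_{\mathcal{U}}:\mathcal{U}\to\mathcal{U}$ the algebra homomorphism $u_i\mapsto u_{\theta(i)}$, where $u_i:=0$ if $i\notin[N]$. Then $\theta_{\mathcal{U}}(I_{\mathrm{KR}}^{\mathrm{st}})\subseteq I_{\mathrm{KR}}^{\mathrm{st}}$, so $\theta_{\mathcal{U}}$ induces an algebra homomorphism $\mathcal{U}/I_{\mathrm{KR}}^{\mathrm{st}}\to\mathcal{U}/I_{\mathrm{KR}}^{\mathrm{st}}$. (ii) The same holds for $\theta$ an order-reversing injection. (iii) Let $\mathrm{rev}:\mathcal{U}\to\mathcal{U}$ be the algebra anti-automorphism sending each word $w_1w_2\cdots w_n$ to $w_n\cdots w_2w_1$. Then $\mathrm{rev}(I_{\mathrm{KR}}^{\mathrm{st}})=I_{\mathrm{KR}}^{\mathrm{st}}$, so $\mathrm{rev}$ induces an algebra anti-automorphism of $\mathcal{U}/I_{\mathrm{KR}}^{\mathrm{st}}$.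
   Context: $\mathcal{U}=\mathbb{Z}\langle u_1,\dots,u_N\rangle$; the letter $a$ denotes $u_a$, so monomials are words in $\{1,\dots,N\}$. $I_{\mathrm{KR}}^{\mathrm{st}}$ is the two-sided ideal generated by $b(ac-ca)-(ac-ca)b$ for letters $a<b<c$ and by all words with a repeated letter. -}

module Defs where

open import Data.Nat as ℕ using (ℕ; zero; suc; _<?_)
open import Data.Integer as ℤ using (ℤ; +_; +[1+_]; 0ℤ; 1ℤ)
open import Data.Fin as Fin using (Fin; fromℕ<)
open import Data.List using (List; []; _∷_; _++_; map; concatMap; reverse)
open import Data.List.Properties using (≡-dec)
open import Data.Product using (_×_; _,_; ∃; Σ-syntax)
open import Relation.Nullary using (yes; no)
open import Relation.Binary.PropositionalEquality using (_≡_)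

-- Letters: Fin N, where i : Fin N stands for u_{toℕ i + 1}, i.e. [N] = {1,…,N}.
Word : ℕ → Set
Word N = List (Fin N)

-- Elements of 𝒰 = ℤ⟨u_1,…,u_N⟩ as finite formal ℤ-linear combinations of words.
-- Two representatives denote the same element iff all coefficients agree (_≈_).
Poly : ℕ → Set
Poly N = List (ℤ × Word N)

module _ {N : ℕ} where

  coeff : Poly N → Word N → ℤ
  coeff [] w = 0ℤ
  coeff ((c , v) ∷ p) w with ≡-dec Fin._≟_ v w
  ... | yes _ = c ℤ.+ coeff p w
  ... | no  _ = coeff p w

  infix 4 _≈_
  _≈_ : Poly N → Poly N → Set
  p ≈ q = ∀ w → coeff p w ≡ coeff q w

  zeroP : Poly N
  zeroP = []

  oneP : Poly N
  oneP = (1ℤ , []) ∷ []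

  infixl 6 _+P_ _-P_
  infixl 7 _*P_
  _+P_ : Poly N → Poly N → Poly N
  p +P q = p ++ q

  negP : Poly N → Poly N
  negP = map (λ { (c , w) → (ℤ.- c , w) })

  _-P_ : Poly N → Poly N → Poly N
  p -P q = p +P negP q

  _*P_ : Poly N → Poly N → Poly N
  p *P q = concatMap (λ { (c , v) → map (λ { (d , w) → (c ℤ.* d , v ++ w) }) q }) p

  wordP : Word N → Poly N
  wordP w = (1ℤ , w) ∷ []

  letter : Fin N → Poly N
  letter a = wordP (a ∷ [])

  HasRepeat : Word N → Set
  HasRepeat w = ∃ λ (x : Word N) → ∃ λ (y : Word N) → ∃ λ (z : Word N) → ∃ λ (a : Fin N) →
                w ≡ x ++ (a ∷ y ++ (a ∷ z))

  data KRGen : Poly N → Set where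
    comm-gen : ∀ {a b c : Fin N} → a Fin.< b → b Fin.< c →
      KRGen (letter b *P (letter a *P letter c -P letter c *P letter a)
             -P (letter a *P letter c -P letter c *P letter a) *P letter b)
    repeat-gen : ∀ {w : Word N} → HasRepeat w → KRGen (wordP w)

  data I-KR : Poly N → Set where
    gen  : ∀ {p} → KRGen p → I-KR p
    zero : I-KR zeroP
    add  : ∀ {p q} → I-KR p → I-KR q → I-KR (p +P q)
    mulˡ : ∀ r {p} → I-KR p → I-KR (r *P p)
    mulʳ : ∀ r {p} → I-KR p → I-KR (p *P r)
    resp : ∀ {p q} → p ≈ q → I-KR p → I-KR q

  evalWord : (Fin N → Poly N) → Word N → Poly N
  evalWord f [] = oneP
  evalWord f (a ∷ w) = f a *P evalWord f w

  extend : (Fin N → Poly N) → Poly N → Poly N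
  extend f = concatMap (λ { (c , w) → ((c , []) ∷ []) *P evalWord f w })

  -- u_k for k ∈ ℤ, with u_k := 0 when k ∉ [N] = {1,…,N}
  uℤ : ℤ → Poly N
  uℤ +[1+ n ] with n <? N
  ... | yes n<N = letter (fromℕ< n<N)
  ... | no  _   = zeroP
  uℤ _ = zeroP

  -- θ_𝒰 : u_i ↦ u_{θ(i)}   (θ(i) is θ of the element toℕ i + 1 of [N])
  θ𝒰 : (Fin N → ℤ) → Poly N → Poly N
  θ𝒰 θ = extend (λ i → uℤ (θ i))

  rev : Poly N → Poly N
  rev = map (λ { (c , w) → (c , reverse w) })

  OrderPreserving : (Fin N → ℤ) → Set
  OrderPreserving θ = ∀ {i j : Fin N} → i Fin.< j → θ i ℤ.< θ j

  OrderReversing : (Fin N → ℤ) → Set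
  OrderReversing θ = ∀ {i j : Fin N} → i Fin.< j → θ j ℤ.< θ i

-- A formal sum p = Σ cᵢ wᵢ is read as the linear form ⟦ p ⟧ : h ↦ Σ cᵢ h(wᵢ) on functions
-- from words to ℤ.  Two formal sums have the same coefficients iff they give the same form
-- (a form whose values on all indicator functions vanish is zero), and on forms θ_𝒰 and
-- rev act by precomposition; hence both are additive, respect equality in 𝒰, and are
-- multiplicative, resp. anti-multiplicative.  Such a map sends the ideal generated by a
-- set into the ideal generated by its images, so only generators need checking.  A
-- renaming of letters sends a word with a repeated letter to zero or to another such word,
-- and the relator b(ac − ca) − (ac − ca)b to zero, to a relator (θ increasing), or to minus
-- a relator (θ decreasing, as the relator is antisymmetric in a and c).  Reversal fixes
-- each relator and preserves repeated letters; being an involution it maps I_KR^st onto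
-- itself.

module Submission where

open import Defs
open import Data.Bool using (if_then_else_)
open import Data.Empty using (⊥-elim)
open import Data.Fin as Fin using (Fin)
import Data.Fin.Properties as FinP
open import Data.Integer as ℤ using (ℤ; +[1+_]; 0ℤ; 1ℤ; -1ℤ; _+_; _*_; -_)
import Data.Integer.Properties as ℤP
open import Data.Integer.Tactic.RingSolver using (solve-∀)
open import Data.List using (List; []; _∷_; [_]; _++_; map; length; reverse)
import Data.List.Properties as LP
open import Data.List.Relation.Binary.Pointwise using (Pointwise; []; _∷_)
open import Data.Maybe using (Maybe; just; nothing)
open import Data.Maybe.Properties using (just-injective)
open import Data.Nat as ℕ using (ℕ; zero; suc; _≤_; z≤n; s≤s)
import Data.Nat.Properties as ℕP
open import Data.Product using (_×_; _,_; ∃; proj₁; proj₂)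
open import Data.Sum using (_⊎_; inj₁; inj₂)
open import Function using (_∘_)
open import Relation.Binary.Definitions using (DecidableEquality)
open import Relation.Binary.PropositionalEquality
  using (_≡_; refl; sym; trans; cong; cong₂; subst; module ≡-Reasoning)
open import Relation.Nullary using (yes; no; does)

-- Formal sums as linear forms

module _ {A : Set} where

  ⟦_⟧ : List (ℤ × A) → (A → ℤ) → ℤ
  ⟦ [] ⟧ h = 0ℤ
  ⟦ (c , w) ∷ p ⟧ h = c * h w + ⟦ p ⟧ h

  infix 4 _≋_
  record _≋_ (p q : List (ℤ × A)) : Set where
    field agree : ∀ h → ⟦ p ⟧ h ≡ ⟦ q ⟧ h

  open _≋_ public

  ≋-refl : {p : List (ℤ × A)} → p ≋ p
  ≋-refl .agree h = refl

  ≋-sym : {p q : List (ℤ × A)} → p ≋ q → q ≋ p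
  ≋-sym e .agree h = sym (e .agree h)

  ≋-trans : {p q r : List (ℤ × A)} → p ≋ q → q ≋ r → p ≋ r
  ≋-trans e f .agree h = trans (e .agree h) (f .agree h)

  ⟦⟧-++ : ∀ p q h → ⟦ p ++ q ⟧ h ≡ ⟦ p ⟧ h + ⟦ q ⟧ h
  ⟦⟧-++ [] q h = sym (ℤP.+-identityˡ _)
  ⟦⟧-++ ((c , w) ∷ p) q h =
    trans (cong (c * h w +_) (⟦⟧-++ p q h)) (sym (ℤP.+-assoc (c * h w) _ _))

  ⟦⟧-cong : ∀ p {g h : A → ℤ} → (∀ w → g w ≡ h w) → ⟦ p ⟧ g ≡ ⟦ p ⟧ h
  ⟦⟧-cong [] e = refl
  ⟦⟧-cong ((c , w) ∷ p) e = cong₂ (λ x y → c * x + y) (e w) (⟦⟧-cong p e)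

  ⟦⟧-zero : ∀ p → ⟦ p ⟧ (λ _ → 0ℤ) ≡ 0ℤ
  ⟦⟧-zero [] = refl
  ⟦⟧-zero ((c , w) ∷ p) rewrite ⟦⟧-zero p | ℤP.*-zeroʳ c = refl

  ⟦⟧-linear : ∀ p k (g h : A → ℤ) → ⟦ p ⟧ (λ w → k * g w + h w) ≡ k * ⟦ p ⟧ g + ⟦ p ⟧ h
  ⟦⟧-linear [] k g h = sym (trans (ℤP.+-identityʳ _) (ℤP.*-zeroʳ k))
  ⟦⟧-linear ((c , w) ∷ p) k g h rewrite ⟦⟧-linear p k g h =
    regroup c k (g w) (h w) (⟦ p ⟧ g) (⟦ p ⟧ h)
    where
    regroup : ∀ c k x y a b → c * (k * x + y) + (k * a + b) ≡ k * (c * x + a) + (c * y + b)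
    regroup = solve-∀

⟦⟧-swap : ∀ {A B : Set} (p : List (ℤ × A)) (q : List (ℤ × B)) (G : A → B → ℤ) →
          ⟦ p ⟧ (λ x → ⟦ q ⟧ (G x)) ≡ ⟦ q ⟧ (λ y → ⟦ p ⟧ (λ x → G x y))
⟦⟧-swap [] q G = sym (⟦⟧-zero q)
⟦⟧-swap ((c , w) ∷ p) q G =
  trans (cong (c * ⟦ q ⟧ (G w) +_) (⟦⟧-swap p q G))
        (sym (⟦⟧-linear q c (G w) (λ y → ⟦ p ⟧ (λ x → G x y))))

⟦⟧-map : ∀ {A B : Set} (c : ℤ) (g : A → B) (q : List (ℤ × A)) h →
         ⟦ map (λ (d , w) → (c * d , g w)) q ⟧ h ≡ c * ⟦ q ⟧ (λ w → h (g w))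
⟦⟧-map c g [] h = sym (ℤP.*-zeroʳ c)
⟦⟧-map c g ((d , w) ∷ q) h rewrite ⟦⟧-map c g q h = regroup c d (h (g w)) (⟦ q ⟧ (λ w → h (g w)))
  where
  regroup : ∀ c d x y → c * d * x + c * y ≡ c * (d * x + y)
  regroup = solve-∀

module _ {A : Set} (_≟_ : DecidableEquality A) where

  δ : A → A → ℤ
  δ u v = if does (v ≟ u) then 1ℤ else 0ℤ

  remove : A → List (ℤ × A) → List (ℤ × A)
  remove v [] = []
  remove v ((c , w) ∷ p) with w ≟ v
  ... | yes _ = remove v p
  ... | no _  = (c , w) ∷ remove v p

  length-remove : ∀ v p → length (remove v p) ≤ length p
  length-remove v [] = z≤n
  length-remove v ((c , w) ∷ p) with w ≟ v
  ... | yes _ = ℕP.m≤n⇒m≤1+n (length-remove v p)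
  ... | no _  = s≤s (length-remove v p)

  remove-head : ∀ c v p → remove v ((c , v) ∷ p) ≡ remove v p
  remove-head c v p with v ≟ v
  ... | yes _  = refl
  ... | no v≢v = ⊥-elim (v≢v refl)

  ⟦⟧-remove : ∀ v p h → ⟦ p ⟧ h ≡ ⟦ p ⟧ (δ v) * h v + ⟦ remove v p ⟧ h
  ⟦⟧-remove v [] h = refl
  ⟦⟧-remove v ((c , w) ∷ p) h with w ≟ v | ⟦⟧-remove v p h
  ... | yes refl | ih rewrite ih = regroup c (h w) (⟦ p ⟧ (δ w)) (⟦ remove w p ⟧ h)
    where
    regroup : ∀ c x a b → c * x + (a * x + b) ≡ (c * 1ℤ + a) * x + b
    regroup = solve-∀
  ... | no _     | ih rewrite ih = regroup c (h w) (h v) (⟦ p ⟧ (δ v)) (⟦ remove v p ⟧ h)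
    where
    regroup : ∀ c x y a b → c * x + (a * y + b) ≡ (c * 0ℤ + a) * y + (c * x + b)
    regroup = solve-∀

  ⟦⟧-remove-null : ∀ v p → ⟦ p ⟧ (δ v) ≡ 0ℤ → ∀ h → ⟦ p ⟧ h ≡ ⟦ remove v p ⟧ h
  ⟦⟧-remove-null v p null h =
    trans (⟦⟧-remove v p h)
          (trans (cong (λ a → a * h v + ⟦ remove v p ⟧ h) null) (ℤP.+-identityˡ _))

  ⟦⟧-vanishes : ∀ p → (∀ u → ⟦ p ⟧ (δ u) ≡ 0ℤ) → ∀ h → ⟦ p ⟧ h ≡ 0ℤ
  ⟦⟧-vanishes p = go (length p) p ℕP.≤-refl
    where
    go : ∀ n p → length p ≤ n → (∀ u → ⟦ p ⟧ (δ u) ≡ 0ℤ) → ∀ h → ⟦ p ⟧ h ≡ 0ℤ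
    go n [] _ _ h = refl
    go zero (_ ∷ _) ()
    go (suc n) p@((c , v) ∷ q) (s≤s |q|≤n) null h =
      trans (drop-v h) (go n (remove v q) shorter null-rest h)
      where
      drop-v : ∀ h → ⟦ p ⟧ h ≡ ⟦ remove v q ⟧ h
      drop-v h = trans (⟦⟧-remove-null v p (null v) h) (cong (λ r → ⟦ r ⟧ h) (remove-head c v q))
      shorter : length (remove v q) ≤ n
      shorter = ℕP.≤-trans (length-remove v q) |q|≤n
      null-rest : ∀ u → ⟦ remove v q ⟧ (δ u) ≡ 0ℤ
      null-rest u = trans (sym (drop-v (δ u))) (null u)

Pointwise-++⁻ : ∀ {A B : Set} {R : A → B → Set} (xs : List A) ys {zs} → Pointwise R (xs ++ ys) zs →
                ∃ λ xs' → ∃ λ ys' → zs ≡ xs' ++ ys' × Pointwise R xs xs' × Pointwise R ys ys'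
Pointwise-++⁻ [] ys rs = [] , _ , refl , [] , rs
Pointwise-++⁻ (x ∷ xs) ys (r ∷ rs) with Pointwise-++⁻ xs ys rs
... | xs' , ys' , refl , rxs , rys = _ ∷ xs' , ys' , refl , r ∷ rxs , rys

reverse-++-∷ : ∀ {A : Set} (x : List A) a y → reverse (x ++ a ∷ y) ≡ reverse y ++ a ∷ reverse x
reverse-++-∷ x a y = begin
  reverse (x ++ a ∷ y)           ≡⟨ LP.reverse-++ x (a ∷ y) ⟩
  reverse (a ∷ y) ++ reverse x   ≡⟨ cong (_++ reverse x) (LP.unfold-reverse a y) ⟩
  (reverse y ++ [ a ]) ++ reverse x ≡⟨ LP.++-assoc (reverse y) [ a ] (reverse x) ⟩
  reverse y ++ a ∷ reverse x     ∎
  where open ≡-Reasoning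

module _ {N : ℕ} where

  _≟ʷ_ : DecidableEquality (Word N)
  _≟ʷ_ = LP.≡-dec Fin._≟_

  coeff-⟦⟧ : ∀ p w → coeff p w ≡ ⟦ p ⟧ (δ _≟ʷ_ w)
  coeff-⟦⟧ [] w = refl
  coeff-⟦⟧ ((c , v) ∷ p) w with v ≟ʷ w
  ... | yes _ = cong₂ _+_ (sym (ℤP.*-identityʳ c)) (coeff-⟦⟧ p w)
  ... | no _  =
    trans (coeff-⟦⟧ p w)
          (sym (trans (cong (_+ ⟦ p ⟧ (δ _≟ʷ_ w)) (ℤP.*-zeroʳ c)) (ℤP.+-identityˡ _)))

  ⟦⟧-negP : ∀ (p : Poly N) h → ⟦ negP p ⟧ h ≡ - ⟦ p ⟧ h
  ⟦⟧-negP [] h = refl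
  ⟦⟧-negP ((c , w) ∷ p) h rewrite ⟦⟧-negP p h = regroup c (h w) (⟦ p ⟧ h)
    where
    regroup : ∀ c x a → - c * x + - a ≡ - (c * x + a)
    regroup = solve-∀

  ⟦⟧-minus : ∀ (p q : Poly N) h → ⟦ p -P q ⟧ h ≡ ⟦ p ⟧ h ℤ.- ⟦ q ⟧ h
  ⟦⟧-minus p q h = trans (⟦⟧-++ p (negP q) h) (cong (⟦ p ⟧ h +_) (⟦⟧-negP q h))

  ⟦⟧-*P : ∀ (p q : Poly N) h → ⟦ p *P q ⟧ h ≡ ⟦ p ⟧ (λ v → ⟦ q ⟧ (λ w → h (v ++ w)))
  ⟦⟧-*P [] q h = refl
  ⟦⟧-*P ((c , v) ∷ p) q h =
    trans (⟦⟧-++ (map _ q) (p *P q) h) (cong₂ _+_ (⟦⟧-map c (v ++_) q h) (⟦⟧-*P p q h))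

  ≈⇒≋ : {p q : Poly N} → p ≈ q → p ≋ q
  ≈⇒≋ {p} {q} p≈q .agree h =
    ℤP.i-j≡0⇒i≡j _ _ (trans (sym (⟦⟧-minus p q h)) (⟦⟧-vanishes _≟ʷ_ (p -P q) null h))
    where
    null : ∀ u → ⟦ p -P q ⟧ (δ _≟ʷ_ u) ≡ 0ℤ
    null u = begin
      ⟦ p -P q ⟧ (δ _≟ʷ_ u)                  ≡⟨ ⟦⟧-minus p q (δ _≟ʷ_ u) ⟩
      ⟦ p ⟧ (δ _≟ʷ_ u) ℤ.- ⟦ q ⟧ (δ _≟ʷ_ u)  ≡⟨ cong₂ ℤ._-_ (coeff-⟦⟧ p u) refl ⟨
      coeff p u ℤ.- ⟦ q ⟧ (δ _≟ʷ_ u)         ≡⟨ cong₂ ℤ._-_ (trans (p≈q u) (coeff-⟦⟧ q u)) refl ⟩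
      ⟦ q ⟧ (δ _≟ʷ_ u) ℤ.- ⟦ q ⟧ (δ _≟ʷ_ u)  ≡⟨ ℤP.+-inverseʳ (⟦ q ⟧ (δ _≟ʷ_ u)) ⟩
      0ℤ                                     ∎
      where open ≡-Reasoning

  ≋⇒≈ : {p q : Poly N} → p ≋ q → p ≈ q
  ≋⇒≈ {p} {q} p≋q w = trans (coeff-⟦⟧ p w) (trans (p≋q .agree _) (sym (coeff-⟦⟧ q w)))

  I-KR-resp : {p q : Poly N} → p ≋ q → I-KR p → I-KR q
  I-KR-resp p≋q = resp (≋⇒≈ p≋q)

  I-KR-≡zeroP : {p : Poly N} → p ≡ zeroP → I-KR p
  I-KR-≡zeroP p≡0 = subst I-KR (sym p≡0) zero

  *P-cong : {p p' q q' : Poly N} → p ≋ p' → q ≋ q' → p *P q ≋ p' *P q'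
  *P-cong {p} {p'} {q} {q'} p≋p' q≋q' .agree h = begin
    ⟦ p *P q ⟧ h                                  ≡⟨ ⟦⟧-*P p q h ⟩
    ⟦ p ⟧ (λ v → ⟦ q ⟧ (λ w → h (v ++ w)))         ≡⟨ ⟦⟧-cong p (λ v → q≋q' .agree _) ⟩
    ⟦ p ⟧ (λ v → ⟦ q' ⟧ (λ w → h (v ++ w)))        ≡⟨ p≋p' .agree _ ⟩
    ⟦ p' ⟧ (λ v → ⟦ q' ⟧ (λ w → h (v ++ w)))       ≡⟨ ⟦⟧-*P p' q' h ⟨
    ⟦ p' *P q' ⟧ h                                ∎
    where open ≡-Reasoning

  -P-cong : {p p' q q' : Poly N} → p ≋ p' → q ≋ q' → p -P q ≋ p' -P q'
  -P-cong {p} {p'} {q} {q'} p≋p' q≋q' .agree h =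
    trans (⟦⟧-minus p q h) (trans (cong₂ ℤ._-_ (p≋p' .agree h) (q≋q' .agree h)) (sym (⟦⟧-minus p' q' h)))

  *P-assoc : ∀ (p q r : Poly N) → (p *P q) *P r ≋ p *P (q *P r)
  *P-assoc p q r .agree h = begin
    ⟦ (p *P q) *P r ⟧ h
      ≡⟨ trans (⟦⟧-*P (p *P q) r h) (⟦⟧-*P p q _) ⟩
    ⟦ p ⟧ (λ u → ⟦ q ⟧ (λ v → ⟦ r ⟧ (λ w → h ((u ++ v) ++ w))))
      ≡⟨ ⟦⟧-cong p (λ u → ⟦⟧-cong q (λ v → ⟦⟧-cong r (λ w → cong h (LP.++-assoc u v w)))) ⟩
    ⟦ p ⟧ (λ u → ⟦ q ⟧ (λ v → ⟦ r ⟧ (λ w → h (u ++ v ++ w))))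
      ≡⟨ ⟦⟧-cong p (λ u → ⟦⟧-*P q r _) ⟨
    ⟦ p ⟧ (λ u → ⟦ q *P r ⟧ (λ vw → h (u ++ vw)))
      ≡⟨ ⟦⟧-*P p (q *P r) h ⟨
    ⟦ p *P (q *P r) ⟧ h
      ∎
    where open ≡-Reasoning

  *P-identityˡ : ∀ (p : Poly N) → oneP *P p ≋ p
  *P-identityˡ p .agree h = trans (⟦⟧-*P oneP p h) (trans (ℤP.+-identityʳ _) (ℤP.*-identityˡ _))

  *P-identityʳ : ∀ (p : Poly N) → p *P oneP ≋ p
  *P-identityʳ p .agree h = trans (⟦⟧-*P p oneP h) (⟦⟧-cong p unit)
    where
    unit : ∀ v → 1ℤ * h (v ++ []) + 0ℤ ≡ h v
    unit v = trans (ℤP.+-identityʳ _) (trans (ℤP.*-identityˡ _) (cong h (LP.++-identityʳ v)))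

  *P-zeroʳ : ∀ (p : Poly N) → p *P zeroP ≡ zeroP
  *P-zeroʳ [] = refl
  *P-zeroʳ (_ ∷ p) = *P-zeroʳ p

  commutator : Poly N → Poly N → Poly N
  commutator p q = p *P q -P q *P p

  -- b(ac − ca) − (ac − ca)b; on letters it is definitionally the polynomial of comm-gen
  krRelator : Poly N → Poly N → Poly N → Poly N
  krRelator p q r = commutator q (commutator p r)

  commutator-cong : {p p' q q' : Poly N} → p ≋ p' → q ≋ q' → commutator p q ≋ commutator p' q'
  commutator-cong p≋p' q≋q' = -P-cong (*P-cong p≋p' q≋q') (*P-cong q≋q' p≋p')

  krRelator-cong : {p p' q q' r r' : Poly N} → p ≋ p' → q ≋ q' → r ≋ r' →
                   krRelator p q r ≋ krRelator p' q' r'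
  krRelator-cong p≋p' q≋q' r≋r' = commutator-cong q≋q' (commutator-cong p≋p' r≋r')

  commutator-zeroˡ : ∀ (q : Poly N) → commutator zeroP q ≡ zeroP
  commutator-zeroˡ q rewrite *P-zeroʳ q = refl

  commutator-zeroʳ : ∀ (p : Poly N) → commutator p zeroP ≡ zeroP
  commutator-zeroʳ p rewrite *P-zeroʳ p = refl

  krRelator-zero₁ : ∀ (q r : Poly N) → krRelator zeroP q r ≡ zeroP
  krRelator-zero₁ q r rewrite commutator-zeroˡ r = commutator-zeroʳ q

  krRelator-zero₂ : ∀ (p r : Poly N) → krRelator p zeroP r ≡ zeroP
  krRelator-zero₂ p r = commutator-zeroˡ (commutator p r)

  krRelator-zero₃ : ∀ (p q : Poly N) → krRelator p q zeroP ≡ zeroP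
  krRelator-zero₃ p q rewrite commutator-zeroʳ p = commutator-zeroʳ q

  ⟦⟧-extend : ∀ f (p : Poly N) h → ⟦ extend f p ⟧ h ≡ ⟦ p ⟧ (λ w → ⟦ evalWord f w ⟧ h)
  ⟦⟧-extend f [] h = refl
  ⟦⟧-extend f ((c , w) ∷ p) h =
    trans (⟦⟧-++ (((c , []) ∷ []) *P evalWord f w) (extend f p) h)
          (cong₂ _+_ (trans (⟦⟧-*P ((c , []) ∷ []) (evalWord f w) h)
                            (ℤP.+-identityʳ (c * ⟦ evalWord f w ⟧ h)))
                     (⟦⟧-extend f p h))

  extend-cong : ∀ f {p q : Poly N} → p ≋ q → extend f p ≋ extend f q
  extend-cong f {p} {q} p≋q .agree h =
    trans (⟦⟧-extend f p h) (trans (p≋q .agree _) (sym (⟦⟧-extend f q h)))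

  extend-+P : ∀ f (p q : Poly N) → extend f (p +P q) ≡ extend f p +P extend f q
  extend-+P f = LP.concatMap-++ _

  extend-minus : ∀ f (p q : Poly N) → extend f (p -P q) ≋ extend f p -P extend f q
  extend-minus f p q .agree h = begin
    ⟦ extend f (p -P q) ⟧ h                ≡⟨ ⟦⟧-extend f (p -P q) h ⟩
    ⟦ p -P q ⟧ E                           ≡⟨ ⟦⟧-minus p q E ⟩
    ⟦ p ⟧ E ℤ.- ⟦ q ⟧ E                    ≡⟨ cong₂ ℤ._-_ (⟦⟧-extend f p h) (⟦⟧-extend f q h) ⟨
    ⟦ extend f p ⟧ h ℤ.- ⟦ extend f q ⟧ h  ≡⟨ ⟦⟧-minus (extend f p) (extend f q) h ⟨
    ⟦ extend f p -P extend f q ⟧ h         ∎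
    where
    open ≡-Reasoning
    E = λ w → ⟦ evalWord f w ⟧ h

  evalWord-++ : ∀ f (v w : Word N) → evalWord f (v ++ w) ≋ evalWord f v *P evalWord f w
  evalWord-++ f [] w = ≋-sym (*P-identityˡ (evalWord f w))
  evalWord-++ f (a ∷ v) w =
    ≋-trans (*P-cong {f a} ≋-refl (evalWord-++ f v w))
            (≋-sym (*P-assoc (f a) (evalWord f v) (evalWord f w)))

  extend-*P : ∀ f (p q : Poly N) → extend f (p *P q) ≋ extend f p *P extend f q
  extend-*P f p q .agree h = begin
    ⟦ extend f (p *P q) ⟧ h
      ≡⟨ trans (⟦⟧-extend f (p *P q) h) (⟦⟧-*P p q _) ⟩
    ⟦ p ⟧ (λ v → ⟦ q ⟧ (λ w → ⟦ E (v ++ w) ⟧ h))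
      ≡⟨ ⟦⟧-cong p (λ v → ⟦⟧-cong q (λ w →
           trans (evalWord-++ f v w .agree h) (⟦⟧-*P (E v) (E w) h))) ⟩
    ⟦ p ⟧ (λ v → ⟦ q ⟧ (λ w → ⟦ E v ⟧ (λ v' → ⟦ E w ⟧ (λ w' → h (v' ++ w')))))
      ≡⟨ ⟦⟧-cong p (λ v → ⟦⟧-swap q (E v) (λ w v' → ⟦ E w ⟧ (λ w' → h (v' ++ w')))) ⟩
    ⟦ p ⟧ (λ v → ⟦ E v ⟧ (λ v' → ⟦ q ⟧ (λ w → ⟦ E w ⟧ (λ w' → h (v' ++ w')))))
      ≡⟨ ⟦⟧-cong p (λ v → ⟦⟧-cong (E v) (λ v' → ⟦⟧-extend f q _)) ⟨
    ⟦ p ⟧ (λ v → ⟦ E v ⟧ (λ v' → ⟦ extend f q ⟧ (λ w' → h (v' ++ w'))))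
      ≡⟨ trans (⟦⟧-*P (extend f p) (extend f q) h) (⟦⟧-extend f p _) ⟨
    ⟦ extend f p *P extend f q ⟧ h
      ∎
    where
    open ≡-Reasoning
    E = evalWord f

  extend-wordP : ∀ f (w : Word N) → extend f (wordP w) ≋ evalWord f w
  extend-wordP f w .agree h =
    trans (⟦⟧-extend f (wordP w) h) (trans (ℤP.+-identityʳ _) (ℤP.*-identityˡ _))

  extend-letter : ∀ f (a : Fin N) → extend f (letter a) ≋ f a
  extend-letter f a = ≋-trans (extend-wordP f (a ∷ [])) (*P-identityʳ (f a))

  extend-commutator : ∀ f (p q : Poly N) →
    extend f (commutator p q) ≋ commutator (extend f p) (extend f q)
  extend-commutator f p q =
    ≋-trans (extend-minus f (p *P q) (q *P p)) (-P-cong (extend-*P f p q) (extend-*P f q p))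

  extend-krRelator : ∀ f (p q r : Poly N) →
    extend f (krRelator p q r) ≋ krRelator (extend f p) (extend f q) (extend f r)
  extend-krRelator f p q r =
    ≋-trans (extend-commutator f q (commutator p r))
            (commutator-cong {extend f q} ≋-refl (extend-commutator f p r))

  ⟦⟧-rev : ∀ (p : Poly N) h → ⟦ rev p ⟧ h ≡ ⟦ p ⟧ (λ w → h (reverse w))
  ⟦⟧-rev [] h = refl
  ⟦⟧-rev ((c , w) ∷ p) h = cong (c * h (reverse w) +_) (⟦⟧-rev p h)

  rev-cong : {p q : Poly N} → p ≋ q → rev p ≋ rev q
  rev-cong {p} {q} p≋q .agree h = trans (⟦⟧-rev p h) (trans (p≋q .agree _) (sym (⟦⟧-rev q h)))

  rev-+P : ∀ (p q : Poly N) → rev (p +P q) ≡ rev p +P rev q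
  rev-+P = LP.map-++ _

  rev-*P : ∀ (p q : Poly N) → rev (p *P q) ≋ rev q *P rev p
  rev-*P p q .agree h = begin
    ⟦ rev (p *P q) ⟧ h
      ≡⟨ trans (⟦⟧-rev (p *P q) h) (⟦⟧-*P p q _) ⟩
    ⟦ p ⟧ (λ v → ⟦ q ⟧ (λ w → h (reverse (v ++ w))))
      ≡⟨ ⟦⟧-cong p (λ v → ⟦⟧-cong q (λ w → cong h (LP.reverse-++ v w))) ⟩
    ⟦ p ⟧ (λ v → ⟦ q ⟧ (λ w → h (reverse w ++ reverse v)))
      ≡⟨ ⟦⟧-swap p q (λ v w → h (reverse w ++ reverse v)) ⟩
    ⟦ q ⟧ (λ w → ⟦ p ⟧ (λ v → h (reverse w ++ reverse v)))
      ≡⟨ trans (⟦⟧-rev q _) (⟦⟧-cong q (λ w → ⟦⟧-rev p _)) ⟨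
    ⟦ rev q ⟧ (λ w → ⟦ rev p ⟧ (λ v → h (w ++ v)))
      ≡⟨ ⟦⟧-*P (rev q) (rev p) h ⟨
    ⟦ rev q *P rev p ⟧ h
      ∎
    where open ≡-Reasoning

  rev-involutive : ∀ (p : Poly N) → rev (rev p) ≡ p
  rev-involutive [] = refl
  rev-involutive ((c , w) ∷ p) =
    cong₂ (λ v q → (c , v) ∷ q) (LP.reverse-involutive w) (rev-involutive p)

  -- Images of I_KR^st

  rev-krRelator : ∀ (a b c : Fin N) →
    rev (krRelator (letter a) (letter b) (letter c)) ≋ krRelator (letter a) (letter b) (letter c)
  rev-krRelator a b c .agree h =
    palindrome (h (b ∷ a ∷ c ∷ [])) (h (b ∷ c ∷ a ∷ [])) (h (a ∷ c ∷ b ∷ [])) (h (c ∷ a ∷ b ∷ []))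
    where
    palindrome : ∀ x y z t → 1ℤ * t + (-1ℤ * z + (-1ℤ * y + (1ℤ * x + 0ℤ)))
                           ≡ 1ℤ * x + (-1ℤ * y + (-1ℤ * z + (1ℤ * t + 0ℤ)))
    palindrome = solve-∀

  krRelator-antisym : ∀ (a b c : Fin N) →
    negP (krRelator (letter c) (letter b) (letter a)) ≋ krRelator (letter a) (letter b) (letter c)
  krRelator-antisym a b c .agree h =
    trans (⟦⟧-negP (krRelator (letter c) (letter b) (letter a)) h)
      (antisym (h (b ∷ a ∷ c ∷ [])) (h (b ∷ c ∷ a ∷ [])) (h (a ∷ c ∷ b ∷ [])) (h (c ∷ a ∷ b ∷ [])))
    where
    antisym : ∀ x y z t → - (1ℤ * y + (-1ℤ * x + (-1ℤ * t + (1ℤ * z + 0ℤ))))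
                        ≡ 1ℤ * x + (-1ℤ * y + (-1ℤ * z + (1ℤ * t + 0ℤ)))
    antisym = solve-∀

  I-KR-negP : {p : Poly N} → I-KR p → I-KR (negP p)
  I-KR-negP {p} i = I-KR-resp minus-one-times (mulˡ ((-1ℤ , []) ∷ []) i)
    where
    minus-one-times : ((-1ℤ , []) ∷ []) *P p ≋ negP p
    minus-one-times .agree h =
      trans (⟦⟧-*P ((-1ℤ , []) ∷ []) p h)
        (trans (ℤP.+-identityʳ _) (trans (ℤP.-1*i≡-i (⟦ p ⟧ h)) (sym (⟦⟧-negP p h))))

  HasRepeat-Pointwise : {R : Fin N → Fin N → Set} → (∀ {a b b'} → R a b → R a b' → b ≡ b') →
                        {w w' : Word N} → Pointwise R w w' → HasRepeat w → HasRepeat w'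
  HasRepeat-Pointwise functional rs (x , y , z , a , refl) with Pointwise-++⁻ x _ rs
  ... | x' , _ , refl , _ , ra ∷ rs₁ with Pointwise-++⁻ y _ rs₁
  ...   | y' , _ , refl , _ , ra' ∷ _ with functional ra ra'
  ...     | refl = x' , y' , _ , _ , refl

  HasRepeat-reverse : {w : Word N} → HasRepeat w → HasRepeat (reverse w)
  HasRepeat-reverse (x , y , z , a , refl) = reverse z , reverse y , reverse x , a ,
    trans (reverse-++-∷ x a (y ++ a ∷ z))
      (trans (cong (_++ a ∷ reverse x) (reverse-++-∷ y a z))
        (LP.++-assoc (reverse z) (a ∷ reverse y) (a ∷ reverse x)))

  data Multiplicativity (φ : Poly N → Poly N) : Set where
    homomorphic     : (∀ p q → φ (p *P q) ≋ φ p *P φ q) → Multiplicativity φ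
    antihomomorphic : (∀ p q → φ (p *P q) ≋ φ q *P φ p) → Multiplicativity φ

  I-KR-*P-image : ∀ {φ} → Multiplicativity φ → ∀ r {p} →
                  I-KR (φ p) → I-KR (φ (r *P p)) × I-KR (φ (p *P r))
  I-KR-*P-image {φ} (homomorphic φ-*) r {p} i =
    I-KR-resp (≋-sym (φ-* r p)) (mulˡ (φ r) i) , I-KR-resp (≋-sym (φ-* p r)) (mulʳ (φ r) i)
  I-KR-*P-image {φ} (antihomomorphic φ-*) r {p} i =
    I-KR-resp (≋-sym (φ-* r p)) (mulʳ (φ r) i) , I-KR-resp (≋-sym (φ-* p r)) (mulˡ (φ r) i)

  module _ (φ : Poly N → Poly N)
           (φ-cong : ∀ {p q} → p ≋ q → φ p ≋ φ q)
           (φ-zero : φ zeroP ≡ zeroP)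
           (φ-+P : ∀ p q → φ (p +P q) ≡ φ p +P φ q)
           (φ-*P : Multiplicativity φ)
           (φ-gen : ∀ {p} → KRGen p → I-KR (φ p))
           where

    I-KR-image : ∀ {p} → I-KR p → I-KR (φ p)
    I-KR-image (gen g)            = φ-gen g
    I-KR-image zero               = I-KR-≡zeroP φ-zero
    I-KR-image (add {p} {q} i j)  = subst I-KR (sym (φ-+P p q)) (add (I-KR-image i) (I-KR-image j))
    I-KR-image (mulˡ r i)         = proj₁ (I-KR-*P-image φ-*P r (I-KR-image i))
    I-KR-image (mulʳ r i)         = proj₂ (I-KR-*P-image φ-*P r (I-KR-image i))
    I-KR-image (resp p≈q i)       = I-KR-resp (φ-cong (≈⇒≋ p≈q)) (I-KR-image i)

  -- Renamings of letters and θ_𝒰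

  Renaming : Set
  Renaming = Fin N → Maybe (Fin N)

  letter? : Maybe (Fin N) → Poly N
  letter? (just a) = letter a
  letter? nothing  = zeroP

  rename : Renaming → Poly N → Poly N
  rename σ = extend (letter? ∘ σ)

  evalWord-rename : ∀ (σ : Renaming) (w : Word N) → evalWord (letter? ∘ σ) w ≡ zeroP ⊎
    ∃ λ w' → evalWord (letter? ∘ σ) w ≡ wordP w' × Pointwise (λ a b → σ a ≡ just b) w w'
  evalWord-rename σ [] = inj₂ ([] , refl , [])
  evalWord-rename σ (a ∷ w) with σ a in σa≡b
  ... | nothing = inj₁ refl
  ... | just b with evalWord-rename σ w
  ...   | inj₁ e = inj₁ (trans (cong (letter b *P_) e) (*P-zeroʳ (letter b)))
  ...   | inj₂ (w' , e , rs) = inj₂ (b ∷ w' , cong (letter b *P_) e , σa≡b ∷ rs)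

  KRCompatible : Renaming → Set
  KRCompatible σ = ∀ {a b c a' b' c'} → a Fin.< b → b Fin.< c →
    σ a ≡ just a' → σ b ≡ just b' → σ c ≡ just c' → I-KR (krRelator (letter a') (letter b') (letter c'))

  I-KR-krRelator? : ∀ (x y z : Maybe (Fin N)) →
    (∀ {a b c} → x ≡ just a → y ≡ just b → z ≡ just c → I-KR (krRelator (letter a) (letter b) (letter c))) →
    I-KR (krRelator (letter? x) (letter? y) (letter? z))
  I-KR-krRelator? nothing    y          z        _ = I-KR-≡zeroP (krRelator-zero₁ (letter? y) (letter? z))
  I-KR-krRelator? x@(just _) nothing    z        _ = I-KR-≡zeroP (krRelator-zero₂ (letter? x) (letter? z))
  I-KR-krRelator? x@(just _) y@(just _) nothing  _ = I-KR-≡zeroP (krRelator-zero₃ (letter? x) (letter? y))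
  I-KR-krRelator? (just _)   (just _)   (just _) k = k refl refl refl

  rename-KRGen : ∀ (σ : Renaming) → KRCompatible σ → ∀ {p} → KRGen p → I-KR (rename σ p)
  rename-KRGen σ compatible (comm-gen {a} {b} {c} a<b b<c) =
    I-KR-resp (≋-sym image) (I-KR-krRelator? (σ a) (σ b) (σ c) (compatible a<b b<c))
    where
    f = letter? ∘ σ
    image : rename σ (krRelator (letter a) (letter b) (letter c)) ≋ krRelator (f a) (f b) (f c)
    image = ≋-trans (extend-krRelator f (letter a) (letter b) (letter c))
                    (krRelator-cong (extend-letter f a) (extend-letter f b) (extend-letter f c))
  rename-KRGen σ compatible (repeat-gen {w} rep) with evalWord-rename σ w
  ... | inj₁ e = I-KR-resp (≋-sym (extend-wordP (letter? ∘ σ) w)) (I-KR-≡zeroP e)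
  ... | inj₂ (w' , e , rs) = I-KR-resp (≋-sym (extend-wordP (letter? ∘ σ) w))
          (subst I-KR (sym e) (gen (repeat-gen (HasRepeat-Pointwise just-functional rs rep))))
    where
    just-functional : ∀ {a b b'} → σ a ≡ just b → σ a ≡ just b' → b ≡ b'
    just-functional e e' = just-injective (trans (sym e) e')

  rename-I-KR : ∀ (σ : Renaming) → KRCompatible σ → ∀ {p} → I-KR p → I-KR (rename σ p)
  rename-I-KR σ compatible =
    I-KR-image (rename σ) (extend-cong (letter? ∘ σ)) refl (extend-+P (letter? ∘ σ))
      (homomorphic (extend-*P (letter? ∘ σ))) (rename-KRGen σ compatible)

  rev-KRGen : ∀ {p : Poly N} → KRGen p → I-KR (rev p)
  rev-KRGen g@(comm-gen {a} {b} {c} _ _) = I-KR-resp (≋-sym (rev-krRelator a b c)) (gen g)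
  rev-KRGen (repeat-gen rep) = gen (repeat-gen (HasRepeat-reverse rep))

  rev-I-KR : ∀ {p : Poly N} → I-KR p → I-KR (rev p)
  rev-I-KR = I-KR-image rev rev-cong refl rev-+P (antihomomorphic rev-*P) rev-KRGen

  index : ℤ → Maybe (Fin N)
  index +[1+ n ] with n ℕ.<? N
  ... | yes n<N = just (Fin.fromℕ< n<N)
  ... | no _    = nothing
  index _ = nothing

  uℤ≡letter?-index : ∀ k → uℤ k ≡ letter? (index k)
  uℤ≡letter?-index +[1+ n ] with n ℕ.<? N
  ... | yes _ = refl
  ... | no _  = refl
  uℤ≡letter?-index (ℤ.+ 0)    = refl
  uℤ≡letter?-index ℤ.-[1+ n ] = refl

  index-just : ∀ {k : ℤ} {a : Fin N} → index k ≡ just a → k ≡ +[1+ Fin.toℕ a ]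
  index-just {+[1+ n ]} e with n ℕ.<? N | e
  ... | yes n<N | e′ =
    cong +[1+_] (trans (sym (FinP.toℕ-fromℕ< n<N)) (cong Fin.toℕ (just-injective e′)))
  ... | no _    | ()
  index-just {ℤ.+ 0}    ()
  index-just {ℤ.-[1+ n ]} ()

  index-mono : ∀ {k l : ℤ} {a b : Fin N} → index k ≡ just a → index l ≡ just b → k ℤ.< l → a Fin.< b
  index-mono {k} {l} ka lb k<l with index-just {k} ka | index-just {l} lb
  ... | refl | refl = ℕ.s<s⁻¹ (ℤP.drop‿+<+ k<l)

  evalWord-pointwise : ∀ {f g : Fin N → Poly N} → (∀ a → f a ≡ g a) →
                       ∀ w → evalWord f w ≡ evalWord g w
  evalWord-pointwise f≗g []      = refl
  evalWord-pointwise f≗g (a ∷ w) = cong₂ _*P_ (f≗g a) (evalWord-pointwise f≗g w)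

  extend-pointwise : ∀ {f g : Fin N → Poly N} → (∀ a → f a ≡ g a) → ∀ p → extend f p ≡ extend g p
  extend-pointwise f≗g =
    LP.concatMap-cong λ (c , w) → cong (((c , []) ∷ []) *P_) (evalWord-pointwise f≗g w)

  θ𝒰≡rename : ∀ θ (p : Poly N) → θ𝒰 θ p ≡ rename (index ∘ θ) p
  θ𝒰≡rename θ = extend-pointwise (uℤ≡letter?-index ∘ θ)

  θ𝒰-I-KR : ∀ θ → KRCompatible (index ∘ θ) → ∀ (p : Poly N) → I-KR p → I-KR (θ𝒰 θ p)
  θ𝒰-I-KR θ compatible p i = subst I-KR (sym (θ𝒰≡rename θ p)) (rename-I-KR (index ∘ θ) compatible i)

  OrderPreserving⇒KRCompatible : ∀ {θ} → OrderPreserving θ → KRCompatible (index ∘ θ)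
  OrderPreserving⇒KRCompatible mono a<b b<c ea eb ec =
    gen (comm-gen (index-mono ea eb (mono a<b)) (index-mono eb ec (mono b<c)))

  OrderReversing⇒KRCompatible : ∀ {θ} → OrderReversing θ → KRCompatible (index ∘ θ)
  OrderReversing⇒KRCompatible anti a<b b<c ea eb ec = I-KR-resp (krRelator-antisym _ _ _)
    (I-KR-negP (gen (comm-gen (index-mono ec eb (anti b<c)) (index-mono eb ea (anti a<b)))))

proposition2p6 : (N : ℕ) →
    ((θ : Fin N → ℤ) → OrderPreserving θ →
       ∀ (p : Poly N) → I-KR p → I-KR (θ𝒰 θ p))
    × ((θ : Fin N → ℤ) → OrderReversing θ →
       ∀ (p : Poly N) → I-KR p → I-KR (θ𝒰 θ p))
    × ((∀ (p : Poly N) → I-KR p → I-KR (rev p))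
       × (∀ (p : Poly N) → I-KR p → ∃ λ (q : Poly N) → I-KR q × (rev q ≈ p)))
proposition2p6 N =
    (λ θ mono → θ𝒰-I-KR θ (OrderPreserving⇒KRCompatible mono))
  , (λ θ anti → θ𝒰-I-KR θ (OrderReversing⇒KRCompatible anti))
  , (λ p → rev-I-KR)
  , (λ p i → rev p , rev-I-KR i , λ w → cong (λ q → coeff q w) (rev-involutive p))
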